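{- Let $q>p\ge3$ be coprime integers, let $\langle p,q\rangle=\{iq+jp : i,j\in\mathbb{Z}_{\ge0}\}$, $\vartheta=(p-1)(q-1)/2$, and list the elements of $\langle p,q\rangle\cap[0,(p-1)(q-1)]$ increasingly as $\ell_0<\ell_1<\dots<\ell_\vartheta$. Then: (i) $\ell_\vartheta=pq-p-q+1$ and $\ell_{\vartheta-1}=pq-p-q-1$, so $\ell_\vartheta-\ell_{\vartheta-1}=2$; (ii) there exists $j$ with $\ell_j+1=\ell_{j+1}$; (iii) there exists $j$ with $1\le j<\vartheta$ and $\ell_j-\ell_{j-1}=2$ if and only if $q>p+1$.
   Context: It is known that $\langle p,q\rangle\cap[0,(p-1)(q-1)]$ has exactly $\vartheta+1$ elements. -}

module Defs where

open import Data.Nat using (ℕ; _+_; _*_; _∸_; _≤_; _<_)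
open import Data.Nat.DivMod using (_/_)
open import Data.Product using (∃-syntax; _×_)
open import Relation.Binary.PropositionalEquality using (_≡_)

InSemigroup : ℕ → ℕ → ℕ → Set
InSemigroup p q n = ∃[ i ] ∃[ j ] n ≡ i * q + j * p

theta : ℕ → ℕ → ℕ
theta p q = ((p ∸ 1) * (q ∸ 1)) / 2

-- ℓ is the increasing listing ℓ₀ < ℓ₁ < … < ℓ_ϑ of ⟨p,q⟩ ∩ [0,(p-1)(q-1)]
-- (only the values ℓ 0 , … , ℓ ϑ are relevant)
IsIncreasingListing : ℕ → ℕ → (ℕ → ℕ) → Set
IsIncreasingListing p q ℓ =
  (∀ i j → i < j → j ≤ theta p q → ℓ i < ℓ j)
  × (∀ k → k ≤ theta p q → InSemigroup p q (ℓ k) × ℓ k ≤ (p ∸ 1) * (q ∸ 1))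
  × (∀ n → InSemigroup p q n → n ≤ (p ∸ 1) * (q ∸ 1) → ∃[ k ] (k ≤ theta p q × ℓ k ≡ n))

{-# OPTIONS --safe #-}
-- Put f = pq − p − q, so that (p − 1)(q − 1) = f + 1. By Bézout every n is congruent mod p to
-- some i q with i < p, so n ∉ ⟨p,q⟩ exactly when n = i q − c p with c ≥ 1. This yields the
-- symmetry "n ∈ ⟨p,q⟩ iff f − n ∉ ⟨p,q⟩" and f + 1 ∈ ⟨p,q⟩. Since 0 ∈ ⟨p,q⟩ and 1, 2 ∉ ⟨p,q⟩,
-- the three largest listed elements are f − 2, f − 1 and f + 1, which gives (i) and (ii); the
-- value of ϑ never enters, only that ℓ_ϑ is the largest listed element. If q > p + 1, then
-- p ∈ ⟨p,q⟩ but p ± 1 ∉ ⟨p,q⟩, so f − p is a gap whose neighbours f − p ∓ 1 are both listed.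
-- If q = p + 1, an isolated gap x + 1 forces x = i (p + 1) and x + 2 = j p, hence p ∣ i + 2 and
-- x + 2 ≥ p (p − 1) = ℓ_ϑ, whereas such a step ends strictly before ℓ_ϑ.
module Submission where

open import Defs
open import Data.Nat using (ℕ; zero; suc; _+_; _*_; _∸_; _≤_; _<_; z≤n; s≤s; NonZero; >-nonZero; >-nonZero⁻¹)
open import Data.Nat.Properties
open import Data.Nat.Coprimality using (Coprime; coprime-Bézout; coprime-divisor)
open import Data.Nat.GCD using (module Bézout)
open import Data.Nat.Divisibility using (_∣_; divides; ∣-refl; ∣m+n∣m⇒∣n; n∣m*n; m∣m*n; ∣⇒≤)
open import Data.Nat.DivMod using (_/_; _%_; m≡m%n+[m/n]*n; m%n<n)
open import Data.Nat.Tactic.RingSolver using (solve)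
open import Data.List using ([]; _∷_)
open import Data.Product using (∃-syntax; _×_; _,_; proj₁; proj₂)
open import Data.Sum using (_⊎_; inj₁; inj₂)
open import Data.Empty using (⊥-elim)
open import Relation.Nullary using (¬_)
open import Function.Bundles using (_⇔_; mk⇔)
open import Relation.Binary.PropositionalEquality

private variable
  p q n m i j k : ℕ

∈-zero : InSemigroup p q 0
∈-zero = 0 , 0 , refl

∈-generator : InSemigroup p q p
∈-generator {p} = 0 , 1 , sym (+-identityʳ p)

∈∧<q⇒p∣ : InSemigroup p q n → n < q → p ∣ n
∈∧<q⇒p∣ (zero , j , n≡jp) _ = divides j n≡jp
∈∧<q⇒p∣ {p} {q} (suc i , j , refl) n<q =
  ⊥-elim (<⇒≱ n<q (≤-trans (m≤m+n q (i * q)) (m≤m+n (q + i * q) (j * p))))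

0<n<p⇒∉ : p ≤ q → 0 < n → n < p → ¬ InSemigroup p q n
0<n<p⇒∉ p≤q 0<n n<p n∈ =
  <⇒≱ n<p (∣⇒≤ {{>-nonZero 0<n}} (∈∧<q⇒p∣ n∈ (<-≤-trans n<p p≤q)))

suc-p∉ : 2 ≤ p → suc p < q → ¬ InSemigroup p q (suc p)
suc-p∉ {p} 2≤p suc-p<q suc-p∈ = <⇒≱ 2≤p (∣⇒≤ p∣1)
  where
  p∣1 : p ∣ 1
  p∣1 = ∣m+n∣m⇒∣n (subst (p ∣_) (+-comm 1 p) (∈∧<q⇒p∣ suc-p∈ suc-p<q)) ∣-refl

n+p+q≤p*q : 3 ≤ p → p ≤ q → n ≤ q → n + p + q ≤ p * q
n+p+q≤p*q {p} {q} {n} 3≤p p≤q n≤q = begin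
  n + p + q  ≤⟨ +-monoˡ-≤ q (+-mono-≤ n≤q p≤q) ⟩
  q + q + q  ≡⟨ solve (q ∷ []) ⟩
  3 * q      ≤⟨ *-monoˡ-≤ q 3≤p ⟩
  p * q      ∎
  where open ≤-Reasoning

conductor+p+q≡suc[p*q] : .{{NonZero p}} → .{{NonZero q}} → (p ∸ 1) * (q ∸ 1) + p + q ≡ suc (p * q)
conductor+p+q≡suc[p*q] {suc a} {suc b} = identity
  where
  identity : a * b + suc a + suc b ≡ suc (suc a * suc b)
  identity = solve (a ∷ b ∷ [])

-- x + 1 ∈ ⟨p, p + 1⟩ as soon as x uses the generator p or x + 2 uses p + 1.
no-isolated-gap-below-conductor : ∀ {x} → suc p ≡ q → InSemigroup p q x → InSemigroup p q (2 + x) →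
                                  ¬ InSemigroup p q (suc x) → (p ∸ 1) * (q ∸ 1) ≤ 2 + x
no-isolated-gap-below-conductor {p} refl (i , suc j , refl) _ suc-x∉ =
  ⊥-elim (suc-x∉ (suc i , j , solve (i ∷ j ∷ p ∷ [])))
no-isolated-gap-below-conductor {p} refl (i , zero , _) (suc i′ , j′ , 2+x≡) suc-x∉ =
  ⊥-elim (suc-x∉ (i′ , suc j′ , suc-injective (trans 2+x≡ (solve (i′ ∷ j′ ∷ p ∷ [])))))
no-isolated-gap-below-conductor {p} refl (i , zero , refl) (zero , j′ , 2+x≡j′p) _ = begin
  (p ∸ 1) * p              ≤⟨ *-monoˡ-≤ p (∸-monoˡ-≤ 1 p≤2+i) ⟩
  p + i * p                ≤⟨ +-monoˡ-≤ (i * p) p≤2+i ⟩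
  2 + i + i * p            ≡⟨ +-comm (2 + i) (i * p) ⟩
  i * p + (2 + i)          ≡⟨ ip+[2+i]≡2+x ⟩
  2 + (i * suc p + 0)      ∎
  where
  open ≤-Reasoning
  ip+[2+i]≡2+x : i * p + (2 + i) ≡ 2 + (i * suc p + 0)
  ip+[2+i]≡2+x = solve (i ∷ p ∷ [])
  p∣2+i : p ∣ 2 + i
  p∣2+i = ∣m+n∣m⇒∣n (divides j′ (trans ip+[2+i]≡2+x 2+x≡j′p)) (n∣m*n i)
  p≤2+i : p ≤ 2 + i
  p≤2+i = ∣⇒≤ p∣2+i

positive-combination≢p*q : Coprime p q → .{{NonZero p}} → ∀ i j → suc i * q + suc j * p ≢ p * q
positive-combination≢p*q {p} {q} coprime i j eq = <-irrefl (sym eq) (begin-strict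
  p * q                    ≤⟨ *-monoˡ-≤ q (∣⇒≤ p∣1+i) ⟩
  suc i * q                <⟨ m<m+n (suc i * q) (<-≤-trans (>-nonZero⁻¹ p) (m≤m+n p (j * p))) ⟩
  suc i * q + suc j * p    ∎)
  where
  open ≤-Reasoning
  p∣[1+j]p+q[1+i] : p ∣ suc j * p + q * suc i
  p∣[1+j]p+q[1+i] = subst (p ∣_) (trans (sym eq) (solve (i ∷ j ∷ p ∷ q ∷ []))) (m∣m*n q)
  p∣1+i : p ∣ suc i
  p∣1+i = coprime-divisor coprime (∣m+n∣m⇒∣n p∣[1+j]p+q[1+i] (n∣m*n (suc j)))

infix 4 _≡_mod_
_≡_mod_ : ℕ → ℕ → ℕ → Set
a ≡ b mod p = ∃[ A ] ∃[ B ] (a + A * p ≡ b + B * p)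

q-invertible-mod-p : Coprime p q → .{{NonZero p}} → ∃[ w ] (w * q ≡ 1 mod p)
q-invertible-mod-p {suc a} {q} coprime with coprime-Bézout coprime
... | Bézout.-+ x y 1+x[1+a]≡yq = y , 0 , x , trans (+-identityʳ (y * q)) (sym 1+x[1+a]≡yq)
-- multiplying 1 + y q ≡ x p by a = p − 1 makes a y an inverse of q
... | Bézout.+- x y 1+yq≡x[1+a] = a * y , 1 , a * x , (begin
  a * y * q + 1 * suc a    ≡⟨ solve (a ∷ y ∷ q ∷ []) ⟩
  1 + a * (1 + y * q)      ≡⟨ cong (λ z → 1 + a * z) 1+yq≡x[1+a] ⟩
  1 + a * (x * suc a)      ≡⟨ solve (a ∷ x ∷ []) ⟩
  1 + a * x * suc a        ∎)
  where open ≡-Reasoning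

multiple-of-q≡mod-p : Coprime p q → .{{NonZero p}} → ∀ n → ∃[ i ] (i < p × i * q ≡ n mod p)
multiple-of-q≡mod-p {p} {q} coprime n with q-invertible-mod-p coprime
... | w , A , B , wq+Ap≡1+Bp
    with (n * w) % p | m%n<n (n * w) p | (n * w) / p | m≡m%n+[m/n]*n (n * w) p
... | r | r<p | d | nw≡r+dp = r , r<p , d * q + n * A , n * B , (begin
  r * q + (d * q + n * A) * p   ≡⟨ solve (r ∷ d ∷ n ∷ A ∷ p ∷ q ∷ []) ⟩
  (r + d * p) * q + n * A * p   ≡⟨ cong (λ z → z * q + n * A * p) (sym nw≡r+dp) ⟩
  n * w * q + n * A * p         ≡⟨ solve (n ∷ w ∷ A ∷ p ∷ q ∷ []) ⟩
  n * (w * q + A * p)           ≡⟨ cong (n *_) wq+Ap≡1+Bp ⟩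
  n * (1 + B * p)               ≡⟨ solve (n ∷ B ∷ p ∷ []) ⟩
  n + n * B * p                 ∎)
  where open ≡-Reasoning

∈⊎negative-combination : Coprime p q → .{{NonZero p}} → ∀ n →
                         InSemigroup p q n ⊎ ∃[ i ] ∃[ c ] (i < p × n + suc c * p ≡ i * q)
∈⊎negative-combination {p} {q} coprime n with multiple-of-q≡mod-p coprime n
... | i , i<p , A , B , iq+Ap≡n+Bp with ≤-<-connex B A
... | inj₁ B≤A with m≤n⇒∃[o]m+o≡n B≤A
... | d , refl = inj₁ (i , d , sym (+-cancelʳ-≡ (B * p) (i * q + d * p) n (begin
  i * q + d * p + B * p    ≡⟨ solve (i ∷ d ∷ B ∷ p ∷ q ∷ []) ⟩
  i * q + (B + d) * p      ≡⟨ iq+Ap≡n+Bp ⟩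
  n + B * p                ∎)))
  where open ≡-Reasoning
∈⊎negative-combination {p} {q} coprime n
    | i , i<p , A , B , iq+Ap≡n+Bp | inj₂ A<B with m≤n⇒∃[o]m+o≡n A<B
... | c , refl = inj₂ (i , c , i<p , sym (+-cancelʳ-≡ (A * p) (i * q) (n + suc c * p) (begin
  i * q + A * p            ≡⟨ iq+Ap≡n+Bp ⟩
  n + (suc A + c) * p      ≡⟨ solve (n ∷ A ∷ c ∷ p ∷ []) ⟩
  n + suc c * p + A * p    ∎)))
  where open ≡-Reasoning

module Frobenius {p q : ℕ} (coprime : Coprime p q) .{{_ : NonZero p}}
                 {f : ℕ} (f+p+q≡p*q : f + p + q ≡ p * q) where

  ∈⇒complement-∉ : n + m ≡ f → InSemigroup p q n → ¬ InSemigroup p q m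
  ∈⇒complement-∉ n+m≡f (i , j , refl) (i′ , j′ , refl) =
    positive-combination≢p*q coprime (i + i′) (j + j′) (begin
      suc (i + i′) * q + suc (j + j′) * p            ≡⟨ solve (i ∷ i′ ∷ j ∷ j′ ∷ p ∷ q ∷ []) ⟩
      (i * q + j * p) + (i′ * q + j′ * p) + p + q    ≡⟨ cong (λ z → z + p + q) n+m≡f ⟩
      f + p + q                                      ≡⟨ f+p+q≡p*q ⟩
      p * q                                          ∎)
    where open ≡-Reasoning

  ∉⇒complement-∈ : n + m ≡ f → ¬ InSemigroup p q n → InSemigroup p q m
  ∉⇒complement-∈ {n} {m} n+m≡f n∉ with ∈⊎negative-combination coprime n
  ... | inj₁ n∈ = ⊥-elim (n∉ n∈)
  ... | inj₂ (i , c , i<p , n+[1+c]p≡iq) with m≤n⇒∃[o]m+o≡n i<p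
  ... | k , 1+i+k≡p = k , c , +-cancelʳ-≡ (n + p + q) m (k * q + c * p) (begin
    m + (n + p + q)                ≡⟨ solve (m ∷ n ∷ p ∷ q ∷ []) ⟩
    (n + m) + p + q                ≡⟨ cong (λ z → z + p + q) n+m≡f ⟩
    f + p + q                      ≡⟨ f+p+q≡p*q ⟩
    p * q                          ≡⟨ cong (_* q) (sym 1+i+k≡p) ⟩
    (suc i + k) * q                ≡⟨ solve (i ∷ k ∷ q ∷ []) ⟩
    q + i * q + k * q              ≡⟨ cong (λ z → q + z + k * q) (sym n+[1+c]p≡iq) ⟩
    q + (n + suc c * p) + k * q    ≡⟨ solve (n ∷ c ∷ k ∷ p ∷ q ∷ []) ⟩
    k * q + c * p + (n + p + q)    ∎)
    where open ≡-Reasoning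

  f<n⇒∈ : f < n → InSemigroup p q n
  f<n⇒∈ {n} f<n with ∈⊎negative-combination coprime n
  ... | inj₁ n∈ = n∈
  ... | inj₂ (i , c , i<p , n+[1+c]p≡iq) = ⊥-elim (<⇒≱ f+p+q<n+p+q (begin
    n + p + q              ≤⟨ +-monoˡ-≤ q (+-monoʳ-≤ n (m≤m+n p (c * p))) ⟩
    n + suc c * p + q      ≡⟨ cong (_+ q) n+[1+c]p≡iq ⟩
    i * q + q              ≡⟨ +-comm (i * q) q ⟩
    suc i * q              ≤⟨ *-monoˡ-≤ q i<p ⟩
    p * q                  ≡⟨ sym f+p+q≡p*q ⟩
    f + p + q              ∎))
    where
    open ≤-Reasoning
    f+p+q<n+p+q : f + p + q < n + p + q
    f+p+q<n+p+q = +-monoˡ-< q (+-monoˡ-< p f<n)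

module Listing {S : ℕ → Set} {N B : ℕ} {ℓ : ℕ → ℕ}
               (increasing : ∀ i j → i < j → j ≤ N → ℓ i < ℓ j)
               (sound : ∀ k → k ≤ N → S (ℓ k) × ℓ k ≤ B)
               (complete : ∀ n → S n → n ≤ B → ∃[ k ] (k ≤ N × ℓ k ≡ n)) where

  ℓ∈ : k ≤ N → S (ℓ k)
  ℓ∈ k≤N = proj₁ (sound _ k≤N)

  ℓ<B : k < N → ℓ k < B
  ℓ<B {k} k<N = <-≤-trans (increasing k N k<N ≤-refl) (proj₂ (sound N ≤-refl))

  monotone : i ≤ j → j ≤ N → ℓ i ≤ ℓ j
  monotone {i} {j} i≤j j≤N with m≤n⇒m<n∨m≡n i≤j
  ... | inj₁ i<j = <⇒≤ (increasing i j i<j j≤N)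
  ... | inj₂ refl = ≤-refl

  ℓ<ℓ⇒< : i ≤ N → ℓ i < ℓ j → i < j
  ℓ<ℓ⇒< {i} {j} i≤N ℓi<ℓj with ≤-<-connex j i
  ... | inj₁ j≤i = ⊥-elim (<⇒≱ ℓi<ℓj (monotone j≤i i≤N))
  ... | inj₂ i<j = i<j

  ℓ-suc≡ : suc j ≤ N → ℓ (suc j) ≡ (ℓ (suc j) ∸ ℓ j) + ℓ j
  ℓ-suc≡ {j} sj≤N = sym (m∸n+n≡m (<⇒≤ (increasing j (suc j) ≤-refl sj≤N)))

  ℓ-last≡ : S B → ℓ N ≡ B
  ℓ-last≡ B∈ with complete B B∈ ≤-refl
  ... | k , k≤N , ℓk≡B = ≤-antisym (proj₂ (sound N ≤-refl)) (subst (_≤ ℓ N) ℓk≡B (monotone k≤N ≤-refl))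

  between-∉ : suc j ≤ N → ℓ j < n → n < ℓ (suc j) → ¬ S n
  between-∉ {j} sj≤N ℓj<n n<ℓsj n∈ with complete _ n∈ (≤-trans (<⇒≤ n<ℓsj) (proj₂ (sound _ sj≤N)))
  ... | k , k≤N , refl = <⇒≱ (ℓ<ℓ⇒< k≤N n<ℓsj) (ℓ<ℓ⇒< (≤-trans (n≤1+n j) sj≤N) ℓj<n)

  next-index : k ≤ N → j ≤ N → ℓ k < ℓ j → (∀ n → ℓ k < n → n < ℓ j → ¬ S n) → j ≡ suc k
  next-index {k} {j} k≤N j≤N ℓk<ℓj nothing-between with m≤n⇒m<n∨m≡n (ℓ<ℓ⇒< k≤N ℓk<ℓj)
  ... | inj₂ sk≡j = sym sk≡j
  ... | inj₁ sk<j = ⊥-elim (nothing-between (ℓ (suc k))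
                      (increasing k (suc k) ≤-refl sk≤N) (increasing (suc k) j sk<j j≤N) (ℓ∈ sk≤N))
    where
    sk≤N : suc k ≤ N
    sk≤N = ≤-trans (<⇒≤ sk<j) j≤N

  index-of-suc : ∀ {x} → k ≤ N → j ≤ N → ℓ k ≡ x → ℓ j ≡ suc x → j ≡ suc k
  index-of-suc {k} k≤N j≤N refl ℓj≡ =
    next-index k≤N j≤N (subst (ℓ k <_) (sym ℓj≡) ≤-refl)
      (λ n ℓk<n n<ℓj → ⊥-elim (<⇒≱ (subst (n <_) ℓj≡ n<ℓj) ℓk<n))

  index-across-gap : ∀ {x} → k ≤ N → j ≤ N → ℓ k ≡ x → ℓ j ≡ 2 + x → ¬ S (suc x) → j ≡ suc k
  index-across-gap {k} k≤N j≤N refl ℓj≡ suc-x∉ =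
    next-index k≤N j≤N (subst (ℓ k <_) (sym ℓj≡) (n≤1+n _))
      (λ n ℓk<n n<ℓj n∈ → suc-x∉ (subst S (≤-antisym (≤-pred (subst (n <_) ℓj≡ n<ℓj)) ℓk<n) n∈))

module Gaps {p q : ℕ} (3≤p : 3 ≤ p) (p<q : p < q) (coprime : Coprime p q)
            {ℓ : ℕ → ℕ} (listing : IsIncreasingListing p q ℓ) where

  S : ℕ → Set
  S = InSemigroup p q

  N f : ℕ
  N = theta p q
  f = p * q ∸ p ∸ q

  1≤p : 1 ≤ p
  1≤p = ≤-trans (s≤s z≤n) 3≤p

  p≤q : p ≤ q
  p≤q = <⇒≤ p<q

  instance
    p-nonZero : NonZero p
    p-nonZero = >-nonZero 1≤p

    q-nonZero : NonZero q
    q-nonZero = >-nonZero (≤-<-trans z≤n p<q)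

  f+p+q≡p*q : f + p + q ≡ p * q
  f+p+q≡p*q = begin
    p * q ∸ p ∸ q + p + q        ≡⟨ +-assoc (p * q ∸ p ∸ q) p q ⟩
    p * q ∸ p ∸ q + (p + q)      ≡⟨ cong (_+ (p + q)) (∸-+-assoc (p * q) p q) ⟩
    p * q ∸ (p + q) + (p + q)    ≡⟨ m∸n+n≡m (n+p+q≤p*q 3≤p p≤q z≤n) ⟩
    p * q                        ∎
    where open ≡-Reasoning

  ≤f : n ≤ q → n ≤ f
  ≤f {n} n≤q = +-cancelʳ-≤ p n f (+-cancelʳ-≤ q (n + p) (f + p)
                 (≤-trans (n+p+q≤p*q 3≤p p≤q n≤q) (≤-reflexive (sym f+p+q≡p*q))))

  conductor≡suc-f : (p ∸ 1) * (q ∸ 1) ≡ suc f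
  conductor≡suc-f = +-cancelʳ-≡ p _ _ (+-cancelʳ-≡ q _ _
                      (trans (conductor+p+q≡suc[p*q] {p} {q}) (cong suc (sym f+p+q≡p*q))))

  open Frobenius coprime f+p+q≡p*q
  open Listing (proj₁ listing) (proj₁ (proj₂ listing)) (proj₂ (proj₂ listing))

  index≤f : S n → n ≤ f → ∃[ k ] (k ≤ N × ℓ k ≡ n)
  index≤f n∈ n≤f = proj₂ (proj₂ listing) _ n∈ (≤-trans (m≤n⇒m≤1+n n≤f) (≤-reflexive (sym conductor≡suc-f)))

  ℓN≡suc-f : ℓ N ≡ suc f
  ℓN≡suc-f = trans (ℓ-last≡ (subst S (sym conductor≡suc-f) (f<n⇒∈ ≤-refl))) conductor≡suc-f

  g : ℕ
  g = f ∸ 2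

  2+g≡f : 2 + g ≡ f
  2+g≡f = m+[n∸m]≡n (≤f (≤-trans (n≤1+n 2) (≤-trans 3≤p p≤q)))

  ℓN≡3+g : ℓ N ≡ 3 + g
  ℓN≡3+g = trans ℓN≡suc-f (cong suc (sym 2+g≡f))

  g∈ : S g
  g∈ = ∉⇒complement-∈ 2+g≡f (0<n<p⇒∉ p≤q (s≤s z≤n) 3≤p)

  suc-g∈ : S (suc g)
  suc-g∈ = ∉⇒complement-∈ 2+g≡f (0<n<p⇒∉ p≤q (s≤s z≤n) (≤-trans (s≤s (s≤s z≤n)) 3≤p))

  2+g∉ : ¬ S (2 + g)
  2+g∉ 2+g∈ = ∈⇒complement-∉ refl ∈-zero (subst S 2+g≡f 2+g∈)

  ℓ[N∸1]≡suc-g : ℓ (N ∸ 1) ≡ suc g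
  ℓ[N∸1]≡suc-g =
    let k , k≤N , ℓk≡suc-g = index≤f suc-g∈ (subst (suc g ≤_) 2+g≡f (n≤1+n (suc g)))
        N≡suc-k = index-across-gap k≤N ≤-refl ℓk≡suc-g ℓN≡3+g 2+g∉
    in trans (cong (λ n → ℓ (n ∸ 1)) N≡suc-k) ℓk≡suc-g

  top-two : ℓ N ≡ f + 1 × ℓ (N ∸ 1) ≡ f ∸ 1 × ℓ N ∸ ℓ (N ∸ 1) ≡ 2
  top-two = trans ℓN≡suc-f (+-comm 1 f) ,
            trans ℓ[N∸1]≡suc-g (cong (_∸ 1) 2+g≡f) ,
            trans (cong₂ _∸_ ℓN≡3+g ℓ[N∸1]≡suc-g) (m+n∸n≡m 2 (suc g))

  consecutive-pair : ∃[ j ] (j < N × ℓ j + 1 ≡ ℓ (j + 1))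
  consecutive-pair =
    let k , k≤N , ℓk≡g = index≤f g∈ (subst (g ≤_) 2+g≡f (m≤n+m g 2))
        N∸1≡suc-k = index-of-suc k≤N (m∸n≤m N 1) ℓk≡g ℓ[N∸1]≡suc-g
    in k , <-≤-trans (subst (k <_) (sym N∸1≡suc-k) ≤-refl) (m∸n≤m N 1) , (begin
      ℓ k + 1      ≡⟨ cong (_+ 1) ℓk≡g ⟩
      g + 1        ≡⟨ +-comm g 1 ⟩
      suc g        ≡⟨ sym ℓ[N∸1]≡suc-g ⟩
      ℓ (N ∸ 1)    ≡⟨ cong ℓ (trans N∸1≡suc-k (+-comm 1 k)) ⟩
      ℓ (k + 1)    ∎)
    where open ≡-Reasoning

  isolated-gap : suc p < q → ∃[ x ] (S x × ¬ S (suc x) × S (2 + x) × 2 + x ≤ f)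
  isolated-gap suc-p<q = x , x∈ , suc-x∉ , 2+x∈ , 2+x≤f
    where
    x : ℕ
    x = f ∸ suc p
    suc-p+x≡f : suc p + x ≡ f
    suc-p+x≡f = m+[n∸m]≡n (≤f (<⇒≤ suc-p<q))
    x∈ : S x
    x∈ = ∉⇒complement-∈ suc-p+x≡f (suc-p∉ (≤-trans (n≤1+n 2) 3≤p) suc-p<q)
    suc-x∉ : ¬ S (suc x)
    suc-x∉ = ∈⇒complement-∉ (trans (+-suc p x) suc-p+x≡f) ∈-generator
    p∸1+[2+x]≡f : (p ∸ 1) + (2 + x) ≡ f
    p∸1+[2+x]≡f = begin
      (p ∸ 1) + (2 + x)      ≡⟨ +-suc (p ∸ 1) (suc x) ⟩
      suc (p ∸ 1) + suc x    ≡⟨ cong (_+ suc x) (m+[n∸m]≡n 1≤p) ⟩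
      p + suc x              ≡⟨ +-suc p x ⟩
      suc p + x              ≡⟨ suc-p+x≡f ⟩
      f                      ∎
      where open ≡-Reasoning
    2+x∈ : S (2 + x)
    2+x∈ = ∉⇒complement-∈ p∸1+[2+x]≡f
             (0<n<p⇒∉ p≤q (m<n⇒0<n∸m (≤-trans (s≤s (s≤s z≤n)) 3≤p)) (∸-monoʳ-< (s≤s z≤n) 1≤p))
    2+x≤f : 2 + x ≤ f
    2+x≤f = subst (2 + x ≤_) suc-p+x≡f (+-monoˡ-≤ x (s≤s 1≤p))

  q>p+1⇒step-of-two : p + 1 < q → ∃[ j ] (1 ≤ j × j < N × ℓ j ∸ ℓ (j ∸ 1) ≡ 2)
  q>p+1⇒step-of-two p+1<q =
    let x , x∈ , suc-x∉ , 2+x∈ , 2+x≤f = isolated-gap (subst (_< q) (+-comm p 1) p+1<q)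
        k , k≤N , ℓk≡x = index≤f x∈ (≤-trans (m≤n+m x 2) 2+x≤f)
        j , j≤N , ℓj≡2+x = index≤f 2+x∈ 2+x≤f
        j≡suc-k = index-across-gap k≤N j≤N ℓk≡x ℓj≡2+x suc-x∉
        ℓ[j∸1]≡x = trans (cong (λ n → ℓ (n ∸ 1)) j≡suc-k) ℓk≡x
    in j , subst (1 ≤_) (sym j≡suc-k) (s≤s z≤n) ,
       ℓ<ℓ⇒< j≤N (subst₂ _<_ (sym ℓj≡2+x) (sym ℓN≡suc-f) (s≤s 2+x≤f)) ,
       trans (cong₂ _∸_ ℓj≡2+x ℓ[j∸1]≡x) (m+n∸n≡m 2 x)

  step-of-two⇒q>p+1 : ∃[ j ] (1 ≤ j × j < N × ℓ j ∸ ℓ (j ∸ 1) ≡ 2) → p + 1 < q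
  step-of-two⇒q>p+1 (suc j , _ , suc-j<N , step≡2) = subst (_< q) (+-comm 1 p) (≤∧≢⇒< p<q suc-p≢q)
    where
    suc-j≤N : suc j ≤ N
    suc-j≤N = <⇒≤ suc-j<N
    ℓ[suc-j]≡2+ℓj : ℓ (suc j) ≡ 2 + ℓ j
    ℓ[suc-j]≡2+ℓj = trans (ℓ-suc≡ suc-j≤N) (cong (_+ ℓ j) step≡2)
    ℓj∈ : S (ℓ j)
    ℓj∈ = ℓ∈ (≤-trans (n≤1+n j) suc-j≤N)
    2+ℓj∈ : S (2 + ℓ j)
    2+ℓj∈ = subst S ℓ[suc-j]≡2+ℓj (ℓ∈ suc-j≤N)
    suc-ℓj∉ : ¬ S (suc (ℓ j))
    suc-ℓj∉ = between-∉ suc-j≤N ≤-refl (subst (suc (ℓ j) <_) (sym ℓ[suc-j]≡2+ℓj) ≤-refl)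
    2+ℓj<conductor : 2 + ℓ j < (p ∸ 1) * (q ∸ 1)
    2+ℓj<conductor = subst (_< _) ℓ[suc-j]≡2+ℓj (ℓ<B suc-j<N)
    suc-p≢q : suc p ≢ q
    suc-p≢q suc-p≡q =
      <⇒≱ 2+ℓj<conductor (no-isolated-gap-below-conductor suc-p≡q ℓj∈ 2+ℓj∈ suc-ℓj∉)

lemma12 : (p q : ℕ) → 3 ≤ p → p < q → Coprime p q → (ℓ : ℕ → ℕ) → IsIncreasingListing p q ℓ →
    ((ℓ (theta p q) ≡ p * q ∸ p ∸ q + 1) × (ℓ (theta p q ∸ 1) ≡ p * q ∸ p ∸ q ∸ 1) × (ℓ (theta p q) ∸ ℓ (theta p q ∸ 1) ≡ 2))
    × (∃[ j ] (j < theta p q × ℓ j + 1 ≡ ℓ (j + 1)))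
    × ((∃[ j ] (1 ≤ j × j < theta p q × ℓ j ∸ ℓ (j ∸ 1) ≡ 2)) ⇔ (p + 1 < q))
lemma12 p q 3≤p p<q coprime ℓ listing =
  top-two , consecutive-pair , mk⇔ step-of-two⇒q>p+1 q>p+1⇒step-of-two
  where open Gaps 3≤p p<q coprime listing
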